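{- Every sequent derivable in $\mathsf{L^m_{RBL}}$ has a derivation in $\mathsf{L^m_{RBL}}$ that does not use $(\mathrm{Mix})$, except for applications of $(\mathrm{Mix})$ whose mix formula is $\bot$ or $\top$.
   Context: $\mathcal{L}_{\mathrm{RBL}}$-formulae are built from propositional letters $p$ by $A::=p\mid\bot\mid\top\mid A\wedge A\mid A\vee A\mid A\cdot A\mid A\rightarrow A\mid A\leftarrow A$. Formula structures: every formula is a formula structure, and if $\Gamma,\Delta$ are formula structures then so are $\Gamma\odot\Delta$ (structural counterpart of $\cdot$) and $\Gamma\mathbin{\bar{\wedge}}\Delta$ (structural counterpart of $\wedge$; written as a circled wedge in the paper). Sequents are $\Gamma\Rightarrow A$ with $\Gamma$ a formula structure and $A$ a formula; $\Gamma[\Delta]$ denotes a structure with a distinguished substructure occurrence $\Delta$. The sequent calculus $\mathsf{L_{RBL}}$ has axioms $A\Rightarrow A$, $A\Rightarrow\top$, $\bot\Rightarrow A$ and rules: $(\rightarrow L)$ from $\Delta\Rightarrow A$ and $\Gamma[B]\Rightarrow C$ infer $\Gamma[\Delta\odot(A\rightarrow B)]\Rightarrow C$; $(\rightarrow R)$ from $A\odot\Gamma\Rightarrow B$ infer $\Gamma\Rightarrow A\rightarrow B$; $(\leftarrow L)$ from $\Gamma[A]\Rightarrow C$ and $\Delta\Rightarrow B$ infer $\Gamma[(A\leftarrow B)\odot\Delta]\Rightarrow C$; $(\leftarrow R)$ from $\Gamma\odot B\Rightarrow A$ infer $\Gamma\Rightarrow A\leftarrow B$ (in $(\rightarrow R),(\leftarrow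 R)$, $\Gamma$ must be nonempty); $(\cdot L)$ from $\Gamma[A\odot B]\Rightarrow C$ infer $\Gamma[A\cdot B]\Rightarrow C$; $(\cdot R)$ from $\Gamma\Rightarrow A$ and $\Delta\Rightarrow B$ infer $\Gamma\odot\Delta\Rightarrow A\cdot B$; $(\wedge L)$ from $\Gamma[A\mathbin{\bar{\wedge}}B]\Rightarrow C$ infer $\Gamma[A\wedge B]\Rightarrow C$; $(\wedge R)$ from $\Gamma\Rightarrow A$ and $\Gamma\Rightarrow B$ infer $\Gamma\Rightarrow A\wedge B$; $(\vee L)$ from $\Gamma[A]\Rightarrow C$ and $\Gamma[B]\Rightarrow C$ infer $\Gamma[A\vee B]\Rightarrow C$; $(\vee R)$ from $\Gamma\Rightarrow A_i$ infer $\Gamma\Rightarrow A_1\vee A_2$ ($i=1,2$); contraction: from $\Gamma[\Delta\mathbin{\bar{\wedge}}\Delta]\Rightarrow A$ infer $\Gamma[\Delta]\Rightarrow A$; restricted $\odot$-contraction: from $\Gamma[(\Lambda\odot\Delta)\odot\Delta]\Rightarrow A$ infer $\Gamma[\Lambda\odot\Delta]\Rightarrow A$ ($\Lambda$ nonempty); exchange: from $\Gamma[\Delta\mathbin{\bar{\wedge}}\Lambda]\Rightarrow A$ infer $\Gamma[\Lambda\mathbin{\bar{\wedge}}\Delta]\Rightarrow A$; associativity of $\mathbin{\bar{\wedge}}$ in both directions: $\Gamma[(\Delta_1\mathbin{\bar{\wedge}}\Delta_2)\mathbin{\bar{\wedge}}\Delta_3]\Rightarrow A$ and $\Gamma[\Delta_1\mathbin{\bar{\wedge}}(\Delta_2\mathbin{\bar{\wedge}}\Delta_3)]\Rightarrow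 A$ are interderivable; weakening: from $\Gamma[\Delta]\Rightarrow A$ infer $\Gamma[\Delta'*\Delta]\Rightarrow A$ and $\Gamma[\Delta*\Delta']\Rightarrow A$ for $*\in\{\mathbin{\bar{\wedge}},\odot\}$; $(\mathrm{Cut})$ from $\Delta\Rightarrow A$ and $\Gamma[A]\Rightarrow B$ infer $\Gamma[\Delta]\Rightarrow B$. $\mathsf{L^m_{RBL}}$ is $\mathsf{L_{RBL}}$ with $(\mathrm{Cut})$ replaced by $(\mathrm{Mix})$: from $\Delta\Rightarrow A$ and $\Gamma[A]\ldots[A]\Rightarrow B$ infer $\Gamma[\Delta]\ldots[\Delta]\Rightarrow B$, where $\Gamma[A]\ldots[A]$ contains at least one occurrence of $A$ and at least one occurrence of $A$ is replaced by $\Delta$. $\mathsf{L^m_{RBL}}$ derives the same sequents as $\mathsf{L_{RBL}}$. -}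

module Defs where

open import Data.Nat using (ℕ)
open import Data.Bool using (Bool; true; false; _∨_)
open import Data.Sum using (_⊎_)
open import Relation.Binary.PropositionalEquality using (_≡_)

infixr 30 _∧'_ _∨'_ _·_
infixr 25 _⇒'_
infixl 25 _⇐'_
data Fm : Set where
  var  : ℕ → Fm
  bot  : Fm
  top  : Fm
  _∧'_ : Fm → Fm → Fm
  _∨'_ : Fm → Fm → Fm
  _·_  : Fm → Fm → Fm
  _⇒'_ : Fm → Fm → Fm
  _⇐'_ : Fm → Fm → Fm

infixl 20 _⊙_ _∧̄_
data Str : Set where
  fm  : Fm → Str
  _⊙_ : Str → Str → Str
  _∧̄_ : Str → Str → Str

data Ctx : Set where
  hole : Ctx
  _⊙ₗ_ : Ctx → Str → Ctx
  _⊙ᵣ_ : Str → Ctx → Ctx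
  _∧ₗ_ : Ctx → Str → Ctx
  _∧ᵣ_ : Str → Ctx → Ctx

_[_] : Ctx → Str → Str
hole [ Δ ] = Δ
(Γ ⊙ₗ Λ) [ Δ ] = (Γ [ Δ ]) ⊙ Λ
(Λ ⊙ᵣ Γ) [ Δ ] = Λ ⊙ (Γ [ Δ ])
(Γ ∧ₗ Λ) [ Δ ] = (Γ [ Δ ]) ∧̄ Λ
(Λ ∧ᵣ Γ) [ Δ ] = Λ ∧̄ (Γ [ Δ ])

-- Repl A Δ b Γ Γ' : Γ' arises from Γ by replacing some occurrences of the
-- formula A (as a leaf of Γ) by Δ; b = true iff at least one occurrence
-- was replaced.
data Repl (A : Fm) (Δ : Str) : Bool → Str → Str → Set where
  replace : Repl A Δ true (fm A) Δ
  keep    : ∀ B → Repl A Δ false (fm B) (fm B)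
  node⊙   : ∀ {b₁ b₂ Γ₁ Γ₁' Γ₂ Γ₂'} → Repl A Δ b₁ Γ₁ Γ₁' → Repl A Δ b₂ Γ₂ Γ₂'
          → Repl A Δ (b₁ ∨ b₂) (Γ₁ ⊙ Γ₂) (Γ₁' ⊙ Γ₂')
  node∧   : ∀ {b₁ b₂ Γ₁ Γ₁' Γ₂ Γ₂'} → Repl A Δ b₁ Γ₁ Γ₁' → Repl A Δ b₂ Γ₂ Γ₂'
          → Repl A Δ (b₁ ∨ b₂) (Γ₁ ∧̄ Γ₂) (Γ₁' ∧̄ Γ₂')

-- Derivations in L^m_RBL, where (Mix) may only be applied with a mix
-- formula A satisfying the predicate MixOK.
-- Full L^m_RBL is  Der (λ _ → ⊤).
data Der (MixOK : Fm → Set) : Str → Fm → Set where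
  ax    : ∀ A → Der MixOK (fm A) A
  axTop : ∀ A → Der MixOK (fm A) top
  axBot : ∀ A → Der MixOK (fm bot) A
  ⇒L : ∀ Γ {Δ A B C} → Der MixOK Δ A → Der MixOK (Γ [ fm B ]) C
     → Der MixOK (Γ [ Δ ⊙ fm (A ⇒' B) ]) C
  ⇒R : ∀ {Γ A B} → Der MixOK (fm A ⊙ Γ) B → Der MixOK Γ (A ⇒' B)
  ⇐L : ∀ Γ {Δ A B C} → Der MixOK (Γ [ fm A ]) C → Der MixOK Δ B
     → Der MixOK (Γ [ fm (A ⇐' B) ⊙ Δ ]) C
  ⇐R : ∀ {Γ A B} → Der MixOK (Γ ⊙ fm B) A → Der MixOK Γ (A ⇐' B)
  ·L : ∀ Γ {A B C} → Der MixOK (Γ [ fm A ⊙ fm B ]) C → Der MixOK (Γ [ fm (A · B) ]) C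
  ·R : ∀ {Γ Δ A B} → Der MixOK Γ A → Der MixOK Δ B → Der MixOK (Γ ⊙ Δ) (A · B)
  ∧L : ∀ Γ {A B C} → Der MixOK (Γ [ fm A ∧̄ fm B ]) C → Der MixOK (Γ [ fm (A ∧' B) ]) C
  ∧R : ∀ {Γ A B} → Der MixOK Γ A → Der MixOK Γ B → Der MixOK Γ (A ∧' B)
  ∨L : ∀ Γ {A B C} → Der MixOK (Γ [ fm A ]) C → Der MixOK (Γ [ fm B ]) C
     → Der MixOK (Γ [ fm (A ∨' B) ]) C
  ∨R₁ : ∀ {Γ A B} → Der MixOK Γ A → Der MixOK Γ (A ∨' B)
  ∨R₂ : ∀ {Γ A B} → Der MixOK Γ B → Der MixOK Γ (A ∨' B)
  contr  : ∀ Γ {Δ A} → Der MixOK (Γ [ Δ ∧̄ Δ ]) A → Der MixOK (Γ [ Δ ]) A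
  contr⊙ : ∀ Γ {Λ Δ A} → Der MixOK (Γ [ (Λ ⊙ Δ) ⊙ Δ ]) A → Der MixOK (Γ [ Λ ⊙ Δ ]) A
  exch   : ∀ Γ {Δ Λ A} → Der MixOK (Γ [ Δ ∧̄ Λ ]) A → Der MixOK (Γ [ Λ ∧̄ Δ ]) A
  assoc₁ : ∀ Γ {Δ₁ Δ₂ Δ₃ A} → Der MixOK (Γ [ (Δ₁ ∧̄ Δ₂) ∧̄ Δ₃ ]) A
         → Der MixOK (Γ [ Δ₁ ∧̄ (Δ₂ ∧̄ Δ₃) ]) A
  assoc₂ : ∀ Γ {Δ₁ Δ₂ Δ₃ A} → Der MixOK (Γ [ Δ₁ ∧̄ (Δ₂ ∧̄ Δ₃) ]) A
         → Der MixOK (Γ [ (Δ₁ ∧̄ Δ₂) ∧̄ Δ₃ ]) A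
  weak∧ₗ : ∀ Γ {Δ A} Δ' → Der MixOK (Γ [ Δ ]) A → Der MixOK (Γ [ Δ' ∧̄ Δ ]) A
  weak∧ᵣ : ∀ Γ {Δ A} Δ' → Der MixOK (Γ [ Δ ]) A → Der MixOK (Γ [ Δ ∧̄ Δ' ]) A
  weak⊙ₗ : ∀ Γ {Δ A} Δ' → Der MixOK (Γ [ Δ ]) A → Der MixOK (Γ [ Δ' ⊙ Δ ]) A
  weak⊙ᵣ : ∀ Γ {Δ A} Δ' → Der MixOK (Γ [ Δ ]) A → Der MixOK (Γ [ Δ ⊙ Δ' ]) A
  mix : ∀ {Δ A Γ Γ' B} → MixOK A → Der MixOK Δ A → Der MixOK Γ B
      → Repl A Δ true Γ Γ' → Der MixOK Γ' B

BotOrTop : Fm → Set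
BotOrTop C = (C ≡ bot) ⊎ (C ≡ top)

-- Mix is generalised to grafting: chosen occurrences of a formula A in the
-- antecedent are replaced, each by its own structure Δᵢ together with a
-- derivation of Δᵢ ⇒ A.  (A mix uses one Δ everywhere, but this is not
-- preserved when a graft is pushed into the copies of Δ left by an earlier
-- mix.)  Grafts of A are eliminated by induction on A and, inside that, on the
-- derivation receiving the graft.  Rules that do not act on a grafted
-- occurrence commute with the graft; a mix on C inside that derivation is
-- redone after the graft, as a graft of C.  When a grafted occurrence is
-- principal in a left rule, the left rules of its derivation of Δ ⇒ A are first
-- permuted below, until that derivation ends in an axiom or a right rule; the
-- principal case then reduces to grafts of the immediate subformulas of A.
-- The only mixes ever introduced replace the ⊥ of an axiom ⊥ ⇒ B, so all mixes
-- of the result are on ⊥ or ⊤.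
module Submission where

open import Defs
open import Data.Unit using (⊤)
open import Data.Bool using (true; false)
open import Data.Sum using (inj₁)
open import Data.Product using (Σ-syntax; _×_; _,_)
open import Function using (_∘_)
open import Relation.Binary.PropositionalEquality using (_≡_; refl; sym; cong; subst)

infix 10 _⊢_
_⊢_ : Str → Fm → Set
Γ ⊢ A = Der BotOrTop Γ A

_∘ᶜ_ : Ctx → Ctx → Ctx
hole ∘ᶜ L = L
(K ⊙ₗ Λ) ∘ᶜ L = (K ∘ᶜ L) ⊙ₗ Λ
(Λ ⊙ᵣ K) ∘ᶜ L = Λ ⊙ᵣ (K ∘ᶜ L)
(K ∧ₗ Λ) ∘ᶜ L = (K ∘ᶜ L) ∧ₗ Λ
(Λ ∧ᵣ K) ∘ᶜ L = Λ ∧ᵣ (K ∘ᶜ L)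

plug-∘ᶜ : ∀ K L X → (K ∘ᶜ L) [ X ] ≡ K [ L [ X ] ]
plug-∘ᶜ hole L X = refl
plug-∘ᶜ (K ⊙ₗ Λ) L X = cong (_⊙ Λ) (plug-∘ᶜ K L X)
plug-∘ᶜ (Λ ⊙ᵣ K) L X = cong (Λ ⊙_) (plug-∘ᶜ K L X)
plug-∘ᶜ (K ∧ₗ Λ) L X = cong (_∧̄ Λ) (plug-∘ᶜ K L X)
plug-∘ᶜ (Λ ∧ᵣ K) L X = cong (Λ ∧̄_) (plug-∘ᶜ K L X)

module _ {B : Fm} where

  from-∘ᶜ : ∀ K L X → (K ∘ᶜ L) [ X ] ⊢ B → K [ L [ X ] ] ⊢ B
  from-∘ᶜ K L X = subst (_⊢ B) (plug-∘ᶜ K L X)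

  to-∘ᶜ : ∀ K L X → K [ L [ X ] ] ⊢ B → (K ∘ᶜ L) [ X ] ⊢ B
  to-∘ᶜ K L X = subst (_⊢ B) (sym (plug-∘ᶜ K L X))

  inside : ∀ K L X Y → ((K ∘ᶜ L) [ X ] ⊢ B → (K ∘ᶜ L) [ Y ] ⊢ B)
         → K [ L [ X ] ] ⊢ B → K [ L [ Y ] ] ⊢ B
  inside K L X Y rule = from-∘ᶜ K L Y ∘ rule ∘ to-∘ᶜ K L X

  inside₂ : ∀ K L X Y Z
          → ((K ∘ᶜ L) [ X ] ⊢ B → (K ∘ᶜ L) [ Y ] ⊢ B → (K ∘ᶜ L) [ Z ] ⊢ B)
          → K [ L [ X ] ] ⊢ B → K [ L [ Y ] ] ⊢ B → K [ L [ Z ] ] ⊢ B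
  inside₂ K L X Y Z rule d e = from-∘ᶜ K L Z (rule (to-∘ᶜ K L X d) (to-∘ᶜ K L Y e))

repl-refl : ∀ {C Π} Γ → Repl C Π false Γ Γ
repl-refl (fm B) = keep B
repl-refl (Γ ⊙ Δ) = node⊙ (repl-refl Γ) (repl-refl Δ)
repl-refl (Γ ∧̄ Δ) = node∧ (repl-refl Γ) (repl-refl Δ)

repl-plug : ∀ K {C Π Γ Γ'} → Repl C Π true Γ Γ' → Repl C Π true (K [ Γ ]) (K [ Γ' ])
repl-plug hole r = r
repl-plug (K ⊙ₗ Λ) r = node⊙ (repl-plug K r) (repl-refl Λ)
repl-plug (Λ ⊙ᵣ K) r = node⊙ (repl-refl Λ) (repl-plug K r)
repl-plug (K ∧ₗ Λ) r = node∧ (repl-plug K r) (repl-refl Λ)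
repl-plug (Λ ∧ᵣ K) r = node∧ (repl-refl Λ) (repl-plug K r)

bot-left : ∀ K B → K [ fm bot ] ⊢ B
bot-left hole B = axBot B
bot-left (K ⊙ₗ Λ) B = weak⊙ᵣ hole Λ (bot-left K B)
bot-left (Λ ⊙ᵣ K) B = weak⊙ₗ hole Λ (bot-left K B)
bot-left (K ∧ₗ Λ) B = weak∧ᵣ hole Λ (bot-left K B)
bot-left (Λ ∧ᵣ K) B = weak∧ₗ hole Λ (bot-left K B)

top-right : ∀ Γ → Γ ⊢ top
top-right (fm F) = axTop F
top-right (Γ ⊙ Δ) = weak⊙ᵣ hole Δ (top-right Γ)
top-right (Γ ∧̄ Δ) = weak∧ᵣ hole Δ (top-right Γ)

infixl 20 _⊙ᵍ_ _∧ᵍ_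
data Graft (A : Fm) : Str → Str → Set where
  graft : ∀ {Δ} → Δ ⊢ A → Graft A (fm A) Δ
  leaf  : ∀ B → Graft A (fm B) (fm B)
  _⊙ᵍ_  : ∀ {Γ₁ Γ₁' Γ₂ Γ₂'} → Graft A Γ₁ Γ₁' → Graft A Γ₂ Γ₂' → Graft A (Γ₁ ⊙ Γ₂) (Γ₁' ⊙ Γ₂')
  _∧ᵍ_  : ∀ {Γ₁ Γ₁' Γ₂ Γ₂'} → Graft A Γ₁ Γ₁' → Graft A Γ₂ Γ₂' → Graft A (Γ₁ ∧̄ Γ₂) (Γ₁' ∧̄ Γ₂')

graft-refl : ∀ {A} Γ → Graft A Γ Γ
graft-refl (fm B) = leaf B
graft-refl (Γ ⊙ Δ) = graft-refl Γ ⊙ᵍ graft-refl Δ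
graft-refl (Γ ∧̄ Δ) = graft-refl Γ ∧ᵍ graft-refl Δ

repl→graft : ∀ {A Δ b Γ Γ'} → Repl A Δ b Γ Γ' → Δ ⊢ A → Graft A Γ Γ'
repl→graft replace d = graft d
repl→graft (keep B) d = leaf B
repl→graft (node⊙ r₁ r₂) d = repl→graft r₁ d ⊙ᵍ repl→graft r₂ d
repl→graft (node∧ r₁ r₂) d = repl→graft r₁ d ∧ᵍ repl→graft r₂ d

GraftCtx : Fm → Ctx → Ctx → Set
GraftCtx A K K' = ∀ {Γ Γ'} → Graft A Γ Γ' → Graft A (K [ Γ ]) (K' [ Γ' ])

graft-plug : ∀ {A} K → GraftCtx A K K
graft-plug hole g = g
graft-plug (K ⊙ₗ Λ) g = graft-plug K g ⊙ᵍ graft-refl Λ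
graft-plug (Λ ⊙ᵣ K) g = graft-refl Λ ⊙ᵍ graft-plug K g
graft-plug (K ∧ₗ Λ) g = graft-plug K g ∧ᵍ graft-refl Λ
graft-plug (Λ ∧ᵣ K) g = graft-refl Λ ∧ᵍ graft-plug K g

data SplitGraft (A : Fm) (K : Ctx) (Γ : Str) : Str → Set where
  split : ∀ {K' Γ'} → GraftCtx A K K' → Graft A Γ Γ' → SplitGraft A K Γ (K' [ Γ' ])

split-graft : ∀ {A} K Γ {Γ'} → Graft A (K [ Γ ]) Γ' → SplitGraft A K Γ Γ'
split-graft hole Γ g = split (λ h → h) g
split-graft (K ⊙ₗ Λ) Γ (g₁ ⊙ᵍ g₂) with split-graft K Γ g₁
... | split {K'} c g = split {K' = K' ⊙ₗ _} (λ h → c h ⊙ᵍ g₂) g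
split-graft (Λ ⊙ᵣ K) Γ (g₁ ⊙ᵍ g₂) with split-graft K Γ g₂
... | split {K'} c g = split {K' = _ ⊙ᵣ K'} (λ h → g₁ ⊙ᵍ c h) g
split-graft (K ∧ₗ Λ) Γ (g₁ ∧ᵍ g₂) with split-graft K Γ g₁
... | split {K'} c g = split {K' = K' ∧ₗ _} (λ h → c h ∧ᵍ g₂) g
split-graft (Λ ∧ᵣ K) Γ (g₁ ∧ᵍ g₂) with split-graft K Γ g₂
... | split {K'} c g = split {K' = _ ∧ᵣ K'} (λ h → g₁ ∧ᵍ c h) g

graft-by-mix : ∀ {C B} → BotOrTop C → ∀ K {Γ Γ'} → Graft C Γ Γ' → K [ Γ ] ⊢ B → K [ Γ' ] ⊢ B
graft-by-mix ok K (graft d) e = mix ok d e (repl-plug K replace)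
graft-by-mix ok K (leaf _) e = e
graft-by-mix ok K (_⊙ᵍ_ {Γ₁} {Γ₁'} {Γ₂} {Γ₂'} g₁ g₂) =
  inside K (Γ₁' ⊙ᵣ hole) Γ₂ Γ₂' (graft-by-mix ok (K ∘ᶜ (Γ₁' ⊙ᵣ hole)) g₂)
  ∘ inside K (hole ⊙ₗ Γ₂) Γ₁ Γ₁' (graft-by-mix ok (K ∘ᶜ (hole ⊙ₗ Γ₂)) g₁)
graft-by-mix ok K (_∧ᵍ_ {Γ₁} {Γ₁'} {Γ₂} {Γ₂'} g₁ g₂) =
  inside K (Γ₁' ∧ᵣ hole) Γ₂ Γ₂' (graft-by-mix ok (K ∘ᶜ (Γ₁' ∧ᵣ hole)) g₂)
  ∘ inside K (hole ∧ₗ Γ₂) Γ₁ Γ₁' (graft-by-mix ok (K ∘ᶜ (hole ∧ₗ Γ₂)) g₁)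

graft-past-repl : ∀ {A C Π b Γ Γ₁ Γ₂} → Repl C Π b Γ Γ₁ → Graft A Γ₁ Γ₂
                → (∀ {Π'} → Graft A Π Π' → Π' ⊢ C)
                → Σ[ Γ' ∈ Str ] (Graft A Γ Γ' × Graft C Γ' Γ₂)
graft-past-repl {C = C} replace g elim = fm C , leaf C , graft (elim g)
graft-past-repl (keep _) g elim = _ , g , graft-refl _
graft-past-repl (node⊙ r₁ r₂) (g₁ ⊙ᵍ g₂) elim
  with graft-past-repl r₁ g₁ elim | graft-past-repl r₂ g₂ elim
... | Γ₁ , h₁ , k₁ | Γ₂ , h₂ , k₂ = Γ₁ ⊙ Γ₂ , h₁ ⊙ᵍ h₂ , k₁ ⊙ᵍ k₂
graft-past-repl (node∧ r₁ r₂) (g₁ ∧ᵍ g₂) elim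
  with graft-past-repl r₁ g₁ elim | graft-past-repl r₂ g₂ elim
... | Γ₁ , h₁ , k₁ | Γ₂ , h₂ , k₂ = Γ₁ ∧̄ Γ₂ , h₁ ∧ᵍ h₂ , k₁ ∧ᵍ k₂

data EndsRight : Str → Fm → Set where
  ax    : ∀ A → EndsRight (fm A) A
  axTop : ∀ A → EndsRight (fm A) top
  axBot : ∀ A → EndsRight (fm bot) A
  ⇒R  : ∀ {Γ A B} → fm A ⊙ Γ ⊢ B → EndsRight Γ (A ⇒' B)
  ⇐R  : ∀ {Γ A B} → Γ ⊙ fm B ⊢ A → EndsRight Γ (A ⇐' B)
  ·R  : ∀ {Γ Δ A B} → Γ ⊢ A → Δ ⊢ B → EndsRight (Γ ⊙ Δ) (A · B)
  ∧R  : ∀ {Γ A B} → Γ ⊢ A → Γ ⊢ B → EndsRight Γ (A ∧' B)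
  ∨R₁ : ∀ {Γ A B} → Γ ⊢ A → EndsRight Γ (A ∨' B)
  ∨R₂ : ∀ {Γ A B} → Γ ⊢ B → EndsRight Γ (A ∨' B)

-- Left and structural rules (and mixes) of Δ ⊢ A permute below the context K.
ends-right-suffices : ∀ {A B} K → (∀ {Δ} → EndsRight Δ A → K [ Δ ] ⊢ B)
                    → ∀ {Δ} → Δ ⊢ A → K [ Δ ] ⊢ B
ends-right-suffices K h (ax X) = h (ax X)
ends-right-suffices K h (axTop X) = h (axTop X)
ends-right-suffices K h (axBot X) = h (axBot X)
ends-right-suffices K h (⇒R a) = h (⇒R a)
ends-right-suffices K h (⇐R a) = h (⇐R a)
ends-right-suffices K h (·R a b) = h (·R a b)
ends-right-suffices K h (∧R a b) = h (∧R a b)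
ends-right-suffices K h (∨R₁ a) = h (∨R₁ a)
ends-right-suffices K h (∨R₂ a) = h (∨R₂ a)
ends-right-suffices K h (⇒L L {Δ} {X} {Y} a b) =
  inside K L (fm Y) (Δ ⊙ fm (X ⇒' Y)) (⇒L (K ∘ᶜ L) a) (ends-right-suffices K h b)
ends-right-suffices K h (⇐L L {Δ} {X} {Y} a b) =
  inside K L (fm X) (fm (X ⇐' Y) ⊙ Δ) (λ a' → ⇐L (K ∘ᶜ L) a' b) (ends-right-suffices K h a)
ends-right-suffices K h (·L L {X} {Y} a) =
  inside K L (fm X ⊙ fm Y) (fm (X · Y)) (·L (K ∘ᶜ L)) (ends-right-suffices K h a)
ends-right-suffices K h (∧L L {X} {Y} a) =
  inside K L (fm X ∧̄ fm Y) (fm (X ∧' Y)) (∧L (K ∘ᶜ L)) (ends-right-suffices K h a)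
ends-right-suffices K h (∨L L {X} {Y} a b) =
  inside₂ K L (fm X) (fm Y) (fm (X ∨' Y)) (∨L (K ∘ᶜ L))
    (ends-right-suffices K h a) (ends-right-suffices K h b)
ends-right-suffices K h (contr L {D} a) =
  inside K L (D ∧̄ D) D (contr (K ∘ᶜ L)) (ends-right-suffices K h a)
ends-right-suffices K h (contr⊙ L {Λ} {D} a) =
  inside K L ((Λ ⊙ D) ⊙ D) (Λ ⊙ D) (contr⊙ (K ∘ᶜ L)) (ends-right-suffices K h a)
ends-right-suffices K h (exch L {D} {Λ} a) =
  inside K L (D ∧̄ Λ) (Λ ∧̄ D) (exch (K ∘ᶜ L)) (ends-right-suffices K h a)
ends-right-suffices K h (assoc₁ L {D₁} {D₂} {D₃} a) =
  inside K L ((D₁ ∧̄ D₂) ∧̄ D₃) (D₁ ∧̄ (D₂ ∧̄ D₃)) (assoc₁ (K ∘ᶜ L)) (ends-right-suffices K h a)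
ends-right-suffices K h (assoc₂ L {D₁} {D₂} {D₃} a) =
  inside K L (D₁ ∧̄ (D₂ ∧̄ D₃)) ((D₁ ∧̄ D₂) ∧̄ D₃) (assoc₂ (K ∘ᶜ L)) (ends-right-suffices K h a)
ends-right-suffices K h (weak∧ₗ L {D} W a) =
  inside K L D (W ∧̄ D) (weak∧ₗ (K ∘ᶜ L) W) (ends-right-suffices K h a)
ends-right-suffices K h (weak∧ᵣ L {D} W a) =
  inside K L D (D ∧̄ W) (weak∧ᵣ (K ∘ᶜ L) W) (ends-right-suffices K h a)
ends-right-suffices K h (weak⊙ₗ L {D} W a) =
  inside K L D (W ⊙ D) (weak⊙ₗ (K ∘ᶜ L) W) (ends-right-suffices K h a)
ends-right-suffices K h (weak⊙ᵣ L {D} W a) =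
  inside K L D (D ⊙ W) (weak⊙ᵣ (K ∘ᶜ L) W) (ends-right-suffices K h a)
ends-right-suffices K h (mix ok a b r) = mix ok a (ends-right-suffices K h b) (repl-plug K r)

-- The remaining premises of a left rule introducing A, and the conclusion's
-- antecedent as a function of the structure that took the place of A.
data LeftPremises (B : Fm) : Fm → (Str → Str) → Set where
  ·L  : ∀ K {C D} → K [ fm C ⊙ fm D ] ⊢ B → LeftPremises B (C · D) (K [_])
  ∧L  : ∀ K {C D} → K [ fm C ∧̄ fm D ] ⊢ B → LeftPremises B (C ∧' D) (K [_])
  ∨L  : ∀ K {C D} → K [ fm C ] ⊢ B → K [ fm D ] ⊢ B → LeftPremises B (C ∨' D) (K [_])
  ⇒L : ∀ K Π {C D} → Π ⊢ C → K [ fm D ] ⊢ B → LeftPremises B (C ⇒' D) (λ Δ → K [ Π ⊙ Δ ])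
  ⇐L : ∀ K Π {C D} → K [ fm C ] ⊢ B → Π ⊢ D → LeftPremises B (C ⇐' D) (λ Δ → K [ Δ ⊙ Π ])

PrincipalCut : Fm → Set
PrincipalCut A = ∀ {B Γ Δ} → LeftPremises B A Γ → Δ ⊢ A → Γ Δ ⊢ B

module GraftElimination {A : Fm} (principal : PrincipalCut A) where

  graft-elim : ∀ {Γ Γ' B} → Γ ⊢ B → Graft A Γ Γ' → Γ' ⊢ B
  graft-elim (ax X) (leaf _) = ax X
  graft-elim (ax _) (graft d) = d
  graft-elim (axTop X) (leaf _) = axTop X
  graft-elim (axTop _) (graft _) = top-right _
  graft-elim (axBot X) (leaf _) = axBot X
  graft-elim (axBot X) (graft d) = mix (inj₁ refl) d (axBot X) replace

  graft-elim (⇒R a) g = ⇒R (graft-elim a (leaf _ ⊙ᵍ g))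
  graft-elim (⇐R a) g = ⇐R (graft-elim a (g ⊙ᵍ leaf _))
  graft-elim (·R a b) (g₁ ⊙ᵍ g₂) = ·R (graft-elim a g₁) (graft-elim b g₂)
  graft-elim (∧R a b) g = ∧R (graft-elim a g) (graft-elim b g)
  graft-elim (∨R₁ a) g = ∨R₁ (graft-elim a g)
  graft-elim (∨R₂ a) g = ∨R₂ (graft-elim a g)

  graft-elim (⇒L K {Δ} {C} {D} a b) g with split-graft K (Δ ⊙ fm (C ⇒' D)) g
  ... | split {K'} c (g' ⊙ᵍ leaf _) = ⇒L K' (graft-elim a g') (graft-elim b (c (leaf D)))
  ... | split {K'} c (_⊙ᵍ_ {Γ₁' = Π} g' (graft d)) =
    principal (⇒L K' Π (graft-elim a g') (graft-elim b (c (leaf D)))) d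
  graft-elim (⇐L K {Δ} {C} {D} a b) g with split-graft K (fm (C ⇐' D) ⊙ Δ) g
  ... | split {K'} c (leaf _ ⊙ᵍ g') = ⇐L K' (graft-elim a (c (leaf C))) (graft-elim b g')
  ... | split {K'} c (_⊙ᵍ_ {Γ₂' = Π} (graft d) g') =
    principal (⇐L K' Π (graft-elim a (c (leaf C))) (graft-elim b g')) d
  graft-elim (·L K {C} {D} a) g with split-graft K (fm (C · D)) g
  ... | split {K'} c (leaf _) = ·L K' (graft-elim a (c (leaf C ⊙ᵍ leaf D)))
  ... | split {K'} c (graft d) = principal (·L K' (graft-elim a (c (leaf C ⊙ᵍ leaf D)))) d
  graft-elim (∧L K {C} {D} a) g with split-graft K (fm (C ∧' D)) g
  ... | split {K'} c (leaf _) = ∧L K' (graft-elim a (c (leaf C ∧ᵍ leaf D)))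
  ... | split {K'} c (graft d) = principal (∧L K' (graft-elim a (c (leaf C ∧ᵍ leaf D)))) d
  graft-elim (∨L K {C} {D} a b) g with split-graft K (fm (C ∨' D)) g
  ... | split {K'} c (leaf _) = ∨L K' (graft-elim a (c (leaf C))) (graft-elim b (c (leaf D)))
  ... | split {K'} c (graft d) =
    principal (∨L K' (graft-elim a (c (leaf C))) (graft-elim b (c (leaf D)))) d

  graft-elim (contr K {D} a) g with split-graft K D g
  ... | split {K'} c h = contr K' (graft-elim a (c (h ∧ᵍ h)))
  graft-elim (contr⊙ K {Λ} {D} a) g with split-graft K (Λ ⊙ D) g
  ... | split {K'} c (h₁ ⊙ᵍ h₂) = contr⊙ K' (graft-elim a (c (h₁ ⊙ᵍ h₂ ⊙ᵍ h₂)))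
  graft-elim (exch K {D} {Λ} a) g with split-graft K (Λ ∧̄ D) g
  ... | split {K'} c (h₁ ∧ᵍ h₂) = exch K' (graft-elim a (c (h₂ ∧ᵍ h₁)))
  graft-elim (assoc₁ K {D₁} {D₂} {D₃} a) g with split-graft K (D₁ ∧̄ (D₂ ∧̄ D₃)) g
  ... | split {K'} c (h₁ ∧ᵍ (h₂ ∧ᵍ h₃)) = assoc₁ K' (graft-elim a (c (h₁ ∧ᵍ h₂ ∧ᵍ h₃)))
  graft-elim (assoc₂ K {D₁} {D₂} {D₃} a) g with split-graft K (D₁ ∧̄ D₂ ∧̄ D₃) g
  ... | split {K'} c (h₁ ∧ᵍ h₂ ∧ᵍ h₃) = assoc₂ K' (graft-elim a (c (h₁ ∧ᵍ (h₂ ∧ᵍ h₃))))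
  graft-elim (weak∧ₗ K {D} W a) g with split-graft K (W ∧̄ D) g
  ... | split {K'} c (_∧ᵍ_ {Γ₁' = W'} _ h) = weak∧ₗ K' W' (graft-elim a (c h))
  graft-elim (weak∧ᵣ K {D} W a) g with split-graft K (D ∧̄ W) g
  ... | split {K'} c (_∧ᵍ_ {Γ₂' = W'} h _) = weak∧ᵣ K' W' (graft-elim a (c h))
  graft-elim (weak⊙ₗ K {D} W a) g with split-graft K (W ⊙ D) g
  ... | split {K'} c (_⊙ᵍ_ {Γ₁' = W'} _ h) = weak⊙ₗ K' W' (graft-elim a (c h))
  graft-elim (weak⊙ᵣ K {D} W a) g with split-graft K (D ⊙ W) g
  ... | split {K'} c (_⊙ᵍ_ {Γ₂' = W'} h _) = weak⊙ᵣ K' W' (graft-elim a (c h))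

  graft-elim (mix ok a b r) g with graft-past-repl r g (graft-elim a)
  ... | _ , g₁ , g₂ = graft-by-mix ok hole g₂ (graft-elim b g₁)

mutual
  eliminate : ∀ A {Γ Γ' B} → Γ ⊢ B → Graft A Γ Γ' → Γ' ⊢ B
  eliminate A = GraftElimination.graft-elim (principal-cut A)

  principal-cut : ∀ A → PrincipalCut A
  principal-cut (var _) ()
  principal-cut bot ()
  principal-cut top ()
  principal-cut (C · D) {B} (·L K e) = ends-right-suffices K reduce
    where
    reduce : ∀ {Δ} → EndsRight Δ (C · D) → K [ Δ ] ⊢ B
    reduce (ax _) = ·L K e
    reduce (axBot _) = bot-left K B
    reduce (·R a b) = eliminate D (eliminate C e (graft-plug K (graft a ⊙ᵍ leaf D)))
                                  (graft-plug K (graft-refl _ ⊙ᵍ graft b))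
  principal-cut (C ∧' D) {B} (∧L K e) = ends-right-suffices K reduce
    where
    -- ∧R shares its antecedent Δ between both premises, so Δ ∧̄ Δ is contracted.
    reduce : ∀ {Δ} → EndsRight Δ (C ∧' D) → K [ Δ ] ⊢ B
    reduce (ax _) = ∧L K e
    reduce (axBot _) = bot-left K B
    reduce {Δ} (∧R a b) = contr K (eliminate D (eliminate C e (graft-plug K (graft a ∧ᵍ leaf D)))
                                               (graft-plug K (graft-refl Δ ∧ᵍ graft b)))
  principal-cut (C ∨' D) {B} (∨L K e₁ e₂) = ends-right-suffices K reduce
    where
    reduce : ∀ {Δ} → EndsRight Δ (C ∨' D) → K [ Δ ] ⊢ B
    reduce (ax _) = ∨L K e₁ e₂
    reduce (axBot _) = bot-left K B
    reduce (∨R₁ a) = eliminate C e₁ (graft-plug K (graft a))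
    reduce (∨R₂ b) = eliminate D e₂ (graft-plug K (graft b))
  principal-cut (C ⇒' D) {B} {Δ = Δ} (⇒L K Π p e) d =
    from-∘ᶜ K (Π ⊙ᵣ hole) Δ (ends-right-suffices (K ∘ᶜ (Π ⊙ᵣ hole)) reduce d)
    where
    reduce : ∀ {X} → EndsRight X (C ⇒' D) → (K ∘ᶜ (Π ⊙ᵣ hole)) [ X ] ⊢ B
    reduce (ax _) = to-∘ᶜ K (Π ⊙ᵣ hole) _ (⇒L K p e)
    reduce (axBot _) = bot-left _ B
    reduce (⇒R a) =
      to-∘ᶜ K (Π ⊙ᵣ hole) _ (eliminate D e (graft-plug K (graft (eliminate C a (graft p ⊙ᵍ graft-refl _)))))
  principal-cut (C ⇐' D) {B} {Δ = Δ} (⇐L K Π e p) d =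
    from-∘ᶜ K (hole ⊙ₗ Π) Δ (ends-right-suffices (K ∘ᶜ (hole ⊙ₗ Π)) reduce d)
    where
    reduce : ∀ {X} → EndsRight X (C ⇐' D) → (K ∘ᶜ (hole ⊙ₗ Π)) [ X ] ⊢ B
    reduce (ax _) = to-∘ᶜ K (hole ⊙ₗ Π) _ (⇐L K e p)
    reduce (axBot _) = bot-left _ B
    reduce (⇐R a) =
      to-∘ᶜ K (hole ⊙ₗ Π) _ (eliminate C e (graft-plug K (graft (eliminate D a (graft-refl _ ⊙ᵍ graft p)))))

mix-elim : ∀ {Γ A} → Der (λ _ → ⊤) Γ A → Γ ⊢ A
mix-elim (ax A) = ax A
mix-elim (axTop A) = axTop A
mix-elim (axBot A) = axBot A
mix-elim (⇒L Γ a b) = ⇒L Γ (mix-elim a) (mix-elim b)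
mix-elim (⇒R a) = ⇒R (mix-elim a)
mix-elim (⇐L Γ a b) = ⇐L Γ (mix-elim a) (mix-elim b)
mix-elim (⇐R a) = ⇐R (mix-elim a)
mix-elim (·L Γ a) = ·L Γ (mix-elim a)
mix-elim (·R a b) = ·R (mix-elim a) (mix-elim b)
mix-elim (∧L Γ a) = ∧L Γ (mix-elim a)
mix-elim (∧R a b) = ∧R (mix-elim a) (mix-elim b)
mix-elim (∨L Γ a b) = ∨L Γ (mix-elim a) (mix-elim b)
mix-elim (∨R₁ a) = ∨R₁ (mix-elim a)
mix-elim (∨R₂ a) = ∨R₂ (mix-elim a)
mix-elim (contr Γ a) = contr Γ (mix-elim a)
mix-elim (contr⊙ Γ a) = contr⊙ Γ (mix-elim a)
mix-elim (exch Γ a) = exch Γ (mix-elim a)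
mix-elim (assoc₁ Γ a) = assoc₁ Γ (mix-elim a)
mix-elim (assoc₂ Γ a) = assoc₂ Γ (mix-elim a)
mix-elim (weak∧ₗ Γ W a) = weak∧ₗ Γ W (mix-elim a)
mix-elim (weak∧ᵣ Γ W a) = weak∧ᵣ Γ W (mix-elim a)
mix-elim (weak⊙ₗ Γ W a) = weak⊙ₗ Γ W (mix-elim a)
mix-elim (weak⊙ᵣ Γ W a) = weak⊙ᵣ Γ W (mix-elim a)
mix-elim (mix {A = A} _ a b r) = eliminate A (mix-elim b) (repl→graft r (mix-elim a))

theorem7 : ∀ (Γ : Str) (A : Fm) → Der (λ _ → ⊤) Γ A → Der BotOrTop Γ A
theorem7 Γ A = mix-elim
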